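{- Let $N=p_1p_2$ for two primes $p_2\ge p_1$, and define $S(N)=\sum_{1<k<N,\ 1<\delta_k<\sqrt N}\mu(k)\left(1-\frac{\delta_k^2}{N}\right)$ with $\delta_k=\gcd(k,N)$ and $\mu(k)$ the smallest positive integer such that $\gcd(\mu(k)k-1,N)=1$. Then $S(N)=p_2-p_1$. -}

module Defs where

open import Data.Nat using (ℕ; zero; suc; _∸_; _<?_) renaming (_*_ to _*ℕ_; _≟_ to _≟ℕ_)
open import Data.Nat.GCD using (gcd)
open import Data.Bool using (Bool; true; false; _∧_; if_then_else_)
open import Data.List using (List; []; _∷_; map; upTo; filterᵇ; foldr)
open import Data.Integer using (+_)
open import Data.Rational using (ℚ; 0ℚ; 1ℚ; _/_; _+_; _-_; _*_)
open import Relation.Nullary using (does)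

-- a / b as a rational, for natural numbers a, b (b = 0 gives 0; never used)
frac : ℕ → ℕ → ℚ
frac a zero    = 0ℚ
frac a (suc b) = (+ a) / suc b

firstWith : (ℕ → Bool) → List ℕ → ℕ
firstWith P []       = 0
firstWith P (x ∷ xs) = if P x then x else firstWith P xs

δ : ℕ → ℕ → ℕ
δ N k = gcd k N

-- μ(k): smallest positive integer m with gcd(m k - 1, N) = 1.
-- The condition depends only on m mod N, so if such m exists, the least
-- one lies in 1..N; we search exactly that range.
μ : ℕ → ℕ → ℕ
μ N k = firstWith (λ m → does (gcd (m *ℕ k ∸ 1) N ≟ℕ 1)) (map suc (upTo N))

-- index condition: 1 < k < N and 1 < δ_k < √N  (δ_k < √N ⇔ δ_k² < N)
inRange : ℕ → ℕ → Bool
inRange N k = does (1 <? k) ∧ does (k <? N) ∧ does (1 <? δ N k)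
              ∧ does ((δ N k *ℕ δ N k) <? N)

S : ℕ → ℚ
S N = foldr _+_ 0ℚ
        (map (λ k → frac (μ N k) 1 * (1ℚ - frac (δ N k *ℕ δ N k) N))
             (filterᵇ (inRange N) (upTo N)))

-- For N = p q with p < q, the indices k in range are exactly the multiples i p with 0 < i < q,
-- all with δ_k = p, so every summand carries the same factor 1 − p²/N = 1 − p/q.
-- Since p ∣ k, neither k − 1 nor 2k − 1 is divisible by p, and 2k − 1 is prime to q when
-- q ∣ k − 1; hence μ(i p) is 2 if i p ≡ 1 (mod q) and 1 otherwise. As p is invertible modulo q,
-- exactly one i in (0, q) qualifies, so Σ μ(i p) = q and S(N) = q (1 − p/q) = q − p.
-- If p = q the common factor 1 − p²/N vanishes.
module Submission where

open import Data.Bool using (Bool; true; false; _∧_; if_then_else_)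
open import Data.Bool.Properties using (¬-not)
open import Data.Empty using (⊥; ⊥-elim)
import Data.Integer as ℤ
import Data.Integer.Properties as ℤ
open import Data.List using ([]; _∷_; map; foldr; filterᵇ; upTo; applyUpTo)
open import Data.Nat
open import Data.Nat.Coprimality using (Coprime; coprime-Bézout; coprime-divisor; prime⇒coprime; coprime⇒gcd≡1)
import Data.Nat.Coprimality as Coprime
open import Data.Nat.Divisibility
open import Data.Nat.DivMod using (m≡m%n+[m/n]*n; m%n<n)
open import Data.Nat.GCD
open import Data.Nat.ListAction using (sum)
open import Data.Nat.Tactic.RingSolver using (solve)
open import Data.Nat.Primality
open import Data.Nat.Properties
open import Data.Product using (_×_; _,_; proj₁; proj₂; ∃-syntax)
open import Data.Rational as ℚ using (ℚ; 0ℚ; 1ℚ; toℚᵘ)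
import Data.Rational.Properties as ℚ
open import Data.Rational.Unnormalised as ℚᵘ using (mkℚᵘ; *≡*)
import Data.Rational.Unnormalised.Properties as ℚᵘ
open import Data.Sum using (_⊎_; inj₁; inj₂)
open import Function using (_∘_; id)
open import Relation.Binary.Definitions using (tri<; tri≈; tri>)
open import Relation.Binary.PropositionalEquality
open import Relation.Nullary using (Dec; contradiction; yes; no; does)
open import Relation.Nullary.Decidable using (dec-true; dec-false)

open import Defs

sumBelow : ℕ → (ℕ → ℕ) → ℕ
sumBelow zero    f = 0
sumBelow (suc n) f = f 0 + sumBelow n (f ∘ suc)

sum-map-applyUpTo : ∀ n (f g : ℕ → ℕ) → sum (map g (applyUpTo f n)) ≡ sumBelow n (g ∘ f)
sum-map-applyUpTo zero    f g = refl
sum-map-applyUpTo (suc n) f g = cong (g (f 0) +_) (sum-map-applyUpTo n (f ∘ suc) g)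

sumBelow-cong : ∀ n {f g : ℕ → ℕ} → (∀ i → i < n → f i ≡ g i) → sumBelow n f ≡ sumBelow n g
sumBelow-cong zero    f≗g = refl
sumBelow-cong (suc n) f≗g = cong₂ _+_ (f≗g 0 z<s) (sumBelow-cong n (λ i i<n → f≗g (suc i) (s<s i<n)))

sumBelow-+ : ∀ m n f → sumBelow (m + n) f ≡ sumBelow m f + sumBelow n (λ i → f (m + i))
sumBelow-+ zero    n f = refl
sumBelow-+ (suc m) n f = trans (cong (f 0 +_) (sumBelow-+ m n (f ∘ suc))) (sym (+-assoc (f 0) _ _))

sumBelow-* : ∀ m n f → sumBelow (m * n) f ≡ sumBelow m (λ i → sumBelow n (λ r → f (i * n + r)))
sumBelow-* zero    n f = refl
sumBelow-* (suc m) n f = begin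
  sumBelow (n + m * n) f
    ≡⟨ sumBelow-+ n (m * n) f ⟩
  sumBelow n f + sumBelow (m * n) (λ i → f (n + i))
    ≡⟨ cong (sumBelow n f +_) (sumBelow-* m n (λ i → f (n + i))) ⟩
  sumBelow n f + sumBelow m (λ i → sumBelow n (λ r → f (n + (i * n + r))))
    ≡⟨ cong (sumBelow n f +_) (sumBelow-cong m (λ i _ → sumBelow-cong n (λ r _ →
         cong f (sym (+-assoc n (i * n) r))))) ⟩
  sumBelow n f + sumBelow m (λ i → sumBelow n (λ r → f (n + i * n + r))) ∎
  where open ≡-Reasoning

sumBelow-const : ∀ n {f c} → (∀ i → i < n → f i ≡ c) → sumBelow n f ≡ n * c
sumBelow-const zero    f≡c = refl
sumBelow-const (suc n) f≡c = cong₂ _+_ (f≡c 0 z<s) (sumBelow-const n (λ i i<n → f≡c (suc i) (s<s i<n)))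

sumBelow-head : ∀ n {f} → 0 < n → (∀ r → 0 < r → r < n → f r ≡ 0) → sumBelow n f ≡ f 0
sumBelow-head (suc n) {f} _ f≡0 = begin
  f 0 + sumBelow n (f ∘ suc) ≡⟨ cong (f 0 +_) (sumBelow-const n (λ i i<n → f≡0 (suc i) z<s (s<s i<n))) ⟩
  f 0 + n * 0                ≡⟨ cong (f 0 +_) (*-zeroʳ n) ⟩
  f 0 + 0                    ≡⟨ +-identityʳ (f 0) ⟩
  f 0                        ∎
  where open ≡-Reasoning

sumBelow-bump : ∀ n {f j} → 0 < j → j < n → f 0 ≡ 0 → f j ≡ 2 →
                (∀ i → 0 < i → i < n → i ≢ j → f i ≡ 1) → sumBelow n f ≡ n
sumBelow-bump (suc n) {f} {suc j} _ (s<s j<n) f0≡0 fj≡2 f≡1 =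
  cong₂ _+_ f0≡0 (shifted n j<n fj≡2 (λ i i<n i≢j → f≡1 (suc i) z<s (s<s i<n) (i≢j ∘ suc-injective)))
  where
  shifted : ∀ n {g j} → j < n → g j ≡ 2 → (∀ i → i < n → i ≢ j → g i ≡ 1) → sumBelow n g ≡ suc n
  shifted (suc n) {g} {zero} _ g0≡2 g≡1 =
    cong₂ _+_ g0≡2 (trans (sumBelow-const n (λ i i<n → g≡1 (suc i) (s<s i<n) λ ())) (*-identityʳ n))
  shifted (suc n) {g} {suc j} (s<s j<n) gj≡2 g≡1 =
    cong₂ _+_ (g≡1 0 z<s λ ()) (shifted n j<n gj≡2 (λ i i<n i≢j → g≡1 (suc i) (s<s i<n) (i≢j ∘ suc-injective)))

toℚᵘ-frac : ∀ a b .{{_ : NonZero b}} → toℚᵘ (frac a b) ℚᵘ.≃ mkℚᵘ (ℤ.+ a) (pred b)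
toℚᵘ-frac a (suc b) = ℚ.toℚᵘ-fromℚᵘ (mkℚᵘ (ℤ.+ a) b)

frac-+ : ∀ a b → frac (a + b) 1 ≡ frac a 1 ℚ.+ frac b 1
frac-+ a b = ℚ.toℚᵘ-injective (begin
  toℚᵘ (frac (a + b) 1)                   ≈⟨ toℚᵘ-frac (a + b) 1 ⟩
  mkℚᵘ (ℤ.+ (a + b)) 0                     ≈⟨ *≡* cross ⟩
  mkℚᵘ (ℤ.+ a) 0 ℚᵘ.+ mkℚᵘ (ℤ.+ b) 0        ≈⟨ ℚᵘ.+-cong (ℚᵘ.≃-sym (toℚᵘ-frac a 1)) (ℚᵘ.≃-sym (toℚᵘ-frac b 1)) ⟩
  toℚᵘ (frac a 1) ℚᵘ.+ toℚᵘ (frac b 1)     ≈⟨ ℚᵘ.≃-sym (ℚ.toℚᵘ-homo-+ (frac a 1) (frac b 1)) ⟩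
  toℚᵘ (frac a 1 ℚ.+ frac b 1)             ∎)
  where
  open ℚᵘ.≃-Reasoning
  cross : ℤ.+ (a + b) ℤ.* ℤ.+ 1 ≡ (ℤ.+ a ℤ.* ℤ.+ 1 ℤ.+ ℤ.+ b ℤ.* ℤ.+ 1) ℤ.* ℤ.+ 1
  cross rewrite ℤ.*-identityʳ (ℤ.+ a) | ℤ.*-identityʳ (ℤ.+ b) | ℤ.*-identityʳ (ℤ.+ (a + b)) = ℤ.pos-+ a b

frac-cancel : ∀ a b c .{{_ : NonZero (c * b)}} → frac (c * a) (c * b) ℚ.* frac b 1 ≡ frac a 1
frac-cancel a b c with c * b in cb≡suc[d]
... | suc d = ℚ.toℚᵘ-injective (begin
  toℚᵘ (frac (c * a) (suc d) ℚ.* frac b 1)               ≈⟨ ℚ.toℚᵘ-homo-* (frac (c * a) (suc d)) (frac b 1) ⟩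
  toℚᵘ (frac (c * a) (suc d)) ℚᵘ.* toℚᵘ (frac b 1)       ≈⟨ ℚᵘ.*-cong (toℚᵘ-frac (c * a) (suc d)) (toℚᵘ-frac b 1) ⟩
  mkℚᵘ (ℤ.+ (c * a)) d ℚᵘ.* mkℚᵘ (ℤ.+ b) 0               ≈⟨ *≡* cross ⟩
  mkℚᵘ (ℤ.+ a) 0                                         ≈⟨ ℚᵘ.≃-sym (toℚᵘ-frac a 1) ⟩
  toℚᵘ (frac a 1)                                        ∎)
  where
  open ℚᵘ.≃-Reasoning
  reassoc : c * a * b ≡ a * (c * b * 1)
  reassoc = solve (a ∷ b ∷ c ∷ [])
  cross : ℤ.+ (c * a) ℤ.* ℤ.+ b ℤ.* ℤ.+ 1 ≡ ℤ.+ a ℤ.* ℤ.+ (suc d * 1)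
  cross = trans (ℤ.*-identityʳ _) (trans (sym (ℤ.pos-* (c * a) b))
            (trans (cong ℤ.+_ (trans reassoc (cong (λ m → a * (m * 1)) cb≡suc[d]))) (ℤ.pos-* a (suc d * 1))))

frac-self : ∀ n .{{_ : NonZero n}} → frac n n ≡ 1ℚ
frac-self (suc n) = ℚ.toℚᵘ-injective (begin
  toℚᵘ (frac (suc n) (suc n)) ≈⟨ toℚᵘ-frac (suc n) (suc n) ⟩
  mkℚᵘ (ℤ.+ suc n) n          ≈⟨ *≡* (ℤ.*-comm (ℤ.+ suc n) (ℤ.+ 1)) ⟩
  mkℚᵘ (ℤ.+ 1) 0              ∎)
  where open ℚᵘ.≃-Reasoning

n*[1-m*m/m*n]≡n∸m : ∀ m n .{{_ : NonZero (m * n)}} → m ≤ n →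
                    frac n 1 ℚ.* (1ℚ ℚ.- frac (m * m) (m * n)) ≡ frac (n ∸ m) 1
n*[1-m*m/m*n]≡n∸m m n m≤n = begin
  N ℚ.* (1ℚ ℚ.- X)            ≡⟨ ℚ.*-distribˡ-+ N 1ℚ (ℚ.- X) ⟩
  N ℚ.* 1ℚ ℚ.+ N ℚ.* ℚ.- X     ≡⟨ cong₂ ℚ._+_ (ℚ.*-identityʳ N) (sym (ℚ.neg-distribʳ-* N X)) ⟩
  N ℚ.- N ℚ.* X               ≡⟨ cong (λ y → N ℚ.- y) (trans (ℚ.*-comm N X) (frac-cancel m n m)) ⟩
  N ℚ.- M                     ≡⟨ cong (ℚ._- M) N≡M+D ⟩
  (M ℚ.+ D) ℚ.- M             ≡⟨ cong (ℚ._- M) (ℚ.+-comm M D) ⟩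
  (D ℚ.+ M) ℚ.- M             ≡⟨ ℚ.+-assoc D M (ℚ.- M) ⟩
  D ℚ.+ (M ℚ.- M)             ≡⟨ cong (D ℚ.+_) (ℚ.+-inverseʳ M) ⟩
  D ℚ.+ 0ℚ                    ≡⟨ ℚ.+-identityʳ D ⟩
  D                           ∎
  where
  open ≡-Reasoning
  N = frac n 1
  M = frac m 1
  D = frac (n ∸ m) 1
  X = frac (m * m) (m * n)
  N≡M+D : N ≡ M ℚ.+ D
  N≡M+D = trans (cong (λ k → frac k 1) (sym (m+[n∸m]≡n m≤n))) (frac-+ m (n ∸ m))

1-n/n≡0 : ∀ n .{{_ : NonZero n}} → 1ℚ ℚ.- frac n n ≡ 0ℚ
1-n/n≡0 n = trans (cong (λ x → 1ℚ ℚ.- x) (frac-self n)) (ℚ.+-inverseʳ 1ℚ)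

sum-map-filterᵇ : (P : ℕ → Bool) (w : ℕ → ℕ) (c : ℚ) (t : ℕ → ℚ) →
              (∀ k → P k ≡ true → t k ≡ frac (w k) 1 ℚ.* c) → ∀ xs →
              foldr ℚ._+_ 0ℚ (map t (filterᵇ P xs))
                ≡ frac (sum (map (λ k → if P k then w k else 0) xs)) 1 ℚ.* c
sum-map-filterᵇ P w c t t≡w*c []       = sym (ℚ.*-zeroˡ c)
sum-map-filterᵇ P w c t t≡w*c (x ∷ xs) with P x in Px
... | false = sum-map-filterᵇ P w c t t≡w*c xs
... | true  = begin
  t x ℚ.+ foldr ℚ._+_ 0ℚ (map t (filterᵇ P xs))  ≡⟨ cong₂ ℚ._+_ (t≡w*c x Px) (sum-map-filterᵇ P w c t t≡w*c xs) ⟩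
  frac (w x) 1 ℚ.* c ℚ.+ frac s 1 ℚ.* c          ≡⟨ ℚ.*-distribʳ-+ c (frac (w x) 1) (frac s 1) ⟨
  (frac (w x) 1 ℚ.+ frac s 1) ℚ.* c              ≡⟨ cong (ℚ._* c) (frac-+ (w x) s) ⟨
  frac (w x + s) 1 ℚ.* c                         ∎
  where
  open ≡-Reasoning
  s = sum (map (λ k → if P k then w k else 0) xs)

∣n⇒∤1+n : ∀ {d n} → 1 < d → d ∣ n → d ∤ suc n
∣n⇒∤1+n {d} {n} 1<d d∣n d∣1+n =
  <⇒≢ 1<d (sym (∣1⇒≡1 (∣m+n∣m⇒∣n (subst (d ∣_) (+-comm 1 n) d∣1+n) d∣n)))

∣n⇒∤n∸1 : ∀ {d n} → 1 < d → 0 < n → d ∣ n → d ∤ n ∸ 1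
∣n⇒∤n∸1 {n = suc n} 1<d _ d∣1+n d∣n = ∣n⇒∤1+n 1<d d∣n d∣1+n

∤⇒coprime : ∀ {p d} → Prime p → p ∤ d → Coprime d p
∤⇒coprime p-prime p∤d {e} (e∣d , e∣p) with prime⇒irreducible p-prime e∣p
... | inj₁ e≡1 = e≡1
... | inj₂ refl = contradiction e∣d p∤d

divisor-of-prime*prime : ∀ {p q d} → Prime p → Prime q → d ∣ p * q →
                         d ≡ 1 ⊎ d ≡ p ⊎ d ≡ q ⊎ d ≡ p * q
divisor-of-prime*prime {p} {q} {d} p-prime q-prime d∣pq with p ∣? d
... | yes (divides e refl) with prime⇒irreducible q-prime e∣q
  where
  instance _ = prime⇒nonZero p-prime
  e∣q : e ∣ q
  e∣q = *-cancelʳ-∣ p (subst (e * p ∣_) (*-comm p q) d∣pq)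
...   | inj₁ refl = inj₂ (inj₁ (*-identityˡ p))
...   | inj₂ refl = inj₂ (inj₂ (inj₂ (*-comm q p)))
divisor-of-prime*prime {p} {q} {d} p-prime q-prime d∣pq | no p∤d
  with prime⇒irreducible q-prime (coprime-divisor (∤⇒coprime p-prime p∤d) d∣pq)
... | inj₁ d≡1 = inj₁ d≡1
... | inj₂ d≡q = inj₂ (inj₂ (inj₁ d≡q))

μ≡1 : ∀ {N} k → 1 < N → gcd (k ∸ 1) N ≡ 1 → μ N k ≡ 1
μ≡1 {suc zero}    k (s<s ()) _
μ≡1 {suc (suc N)} k _ gcd≡1 rewrite *-identityˡ k | gcd≡1 = refl

μ≡2 : ∀ {N} k → 1 < N → gcd (k ∸ 1) N ≢ 1 → gcd (2 * k ∸ 1) N ≡ 1 → μ N k ≡ 2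
μ≡2 {suc zero}    k (s<s ()) _ _
μ≡2 {suc (suc N)} k _ gcd≢1 gcd≡1
  rewrite *-identityˡ k | dec-false (gcd (k ∸ 1) (suc (suc N)) ≟ 1) gcd≢1 | gcd≡1 = refl

inRange-intro : ∀ N k → 1 < k → k < N → 1 < δ N k → δ N k * δ N k < N → inRange N k ≡ true
inRange-intro N k 1<k k<N 1<δ δ²<N =
  cong₂ _∧_ (dec-true (1 <? k) 1<k) (cong₂ _∧_ (dec-true (k <? N) k<N)
    (cong₂ _∧_ (dec-true (1 <? δ N k) 1<δ) (dec-true (δ N k * δ N k <? N) δ²<N)))

inRange-elim : ∀ N k → inRange N k ≡ true → 1 < δ N k × δ N k * δ N k < N
inRange-elim N k inRange≡true =
  conjuncts₃₄ (1 <? k) (k <? N) (1 <? δ N k) (δ N k * δ N k <? N) inRange≡true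
  where
  conjuncts₃₄ : ∀ {A B C D : Set} (a : Dec A) (b : Dec B) (c : Dec C) (d : Dec D) →
                (does a ∧ does b ∧ does c ∧ does d) ≡ true → C × D
  conjuncts₃₄ (yes _) (yes _) (yes c) (yes d) _  = c , d
  conjuncts₃₄ (no _)  _       _       _       ()
  conjuncts₃₄ (yes _) (no _)  _       _       ()
  conjuncts₃₄ (yes _) (yes _) (no _)  _       ()
  conjuncts₃₄ (yes _) (yes _) (yes _) (no _)  ()

∣1+n⇒∣[q∸1]*n∸1 : ∀ {q n} → 1 < q → 0 < n → q ∣ suc n → q ∣ (q ∸ 1) * n ∸ 1
∣1+n⇒∣[q∸1]*n∸1 {suc zero}    (s<s ()) _ _
∣1+n⇒∣[q∸1]*n∸1 {suc (suc r)} {suc m} _ _ q∣1+n =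
  ∣m+n∣m⇒∣n (subst (suc (suc r) ∣_) expand (∣n⇒∣m*n (suc r) q∣1+n)) ∣-refl
  where
  expand : suc r * suc (suc m) ≡ suc (suc r) + (m + r * suc m)
  expand = solve (r ∷ m ∷ [])

module ModularInverse {q a : ℕ} (q-prime : Prime q) (q∤a : q ∤ a) where

  private
    instance
      q≢0 : NonZero q
      q≢0 = prime⇒nonZero q-prime

    1<q : 1 < q
    1<q = nonTrivial⇒n>1 q {{prime⇒nonTrivial q-prime}}

    0<i*a : ∀ {i} → 0 < i → 0 < i * a
    0<i*a 0<i = *-mono-≤ 0<i (n≢0⇒n>0 λ { refl → q∤a (q ∣0) })

    no-two-inverses : ∀ {i j} → 0 < i → i < j → j < q → q ∣ i * a ∸ 1 → q ∣ j * a ∸ 1 → ⊥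
    no-two-inverses {i} {j} 0<i i<j j<q q∣ia∸1 q∣ja∸1
      with euclidsLemma (j ∸ i) a q-prime (∣m+n∣m⇒∣n (subst (q ∣_) split q∣ja∸1) q∣ia∸1)
      where
      split : j * a ∸ 1 ≡ (i * a ∸ 1) + (j ∸ i) * a
      split = begin
        j * a ∸ 1                  ≡⟨ cong (λ m → m * a ∸ 1) (m+[n∸m]≡n (<⇒≤ i<j)) ⟨
        (i + (j ∸ i)) * a ∸ 1      ≡⟨ cong (_∸ 1) (*-distribʳ-+ a i (j ∸ i)) ⟩
        (i * a + (j ∸ i) * a) ∸ 1  ≡⟨ +-∸-comm ((j ∸ i) * a) (0<i*a 0<i) ⟩
        (i * a ∸ 1) + (j ∸ i) * a  ∎
        where open ≡-Reasoning
    ... | inj₁ q∣j∸i = <⇒≱ (≤-<-trans (m∸n≤m j i) j<q) (∣⇒≤ {{>-nonZero (m<n⇒0<n∸m i<j)}} q∣j∸i)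
    ... | inj₂ q∣a   = q∤a q∣a

    reduce-inverse : ∀ x → 0 < x * a → q ∣ x * a ∸ 1 → ∃[ i ] 0 < i × i < q × q ∣ i * a ∸ 1
    reduce-inverse x 0<xa q∣xa∸1 = i , 0<i , m%n<n x q , ∣m+n∣m⇒∣n (subst (q ∣_) split q∣xa∸1) q∣t
      where
      i = x % q
      t = x / q * q * a
      q∣t : q ∣ t
      q∣t = n∣m*n*o (x / q) a
      xa≡ia+t : x * a ≡ i * a + t
      xa≡ia+t = trans (cong (_* a) (m≡m%n+[m/n]*n x q)) (*-distribʳ-+ a i (x / q * q))
      0<i : 0 < i
      0<i = n≢0⇒n>0 λ i≡0 → ∣n⇒∤n∸1 1<q 0<xa
              (subst (q ∣_) (sym (trans xa≡ia+t (cong (λ m → m * a + t) i≡0))) q∣t) q∣xa∸1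
      split : x * a ∸ 1 ≡ t + (i * a ∸ 1)
      split = trans (cong (_∸ 1) xa≡ia+t) (trans (+-∸-comm t (0<i*a 0<i)) (+-comm (i * a ∸ 1) t))

  inverse-unique : ∀ {i j} → 0 < i → i < q → 0 < j → j < q →
                   q ∣ i * a ∸ 1 → q ∣ j * a ∸ 1 → i ≡ j
  inverse-unique {i} {j} 0<i i<q 0<j j<q q∣ia∸1 q∣ja∸1 with <-cmp i j
  ... | tri< i<j _ _ = ⊥-elim (no-two-inverses 0<i i<j j<q q∣ia∸1 q∣ja∸1)
  ... | tri≈ _ i≡j _ = i≡j
  ... | tri> _ _ j<i = ⊥-elim (no-two-inverses 0<j j<i i<q q∣ja∸1 q∣ia∸1)

  inverse-exists : ∃[ i ] 0 < i × i < q × q ∣ i * a ∸ 1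
  inverse-exists with coprime-Bézout (Coprime.sym (∤⇒coprime q-prime q∤a))
  ... | Bézout.-+ x y 1+xq≡ya =
    reduce-inverse y (subst (0 <_) 1+xq≡ya z<s) (divides x (cong (_∸ 1) (sym 1+xq≡ya)))
  ... | Bézout.+- x y 1+ya≡xq =
    -- here y a ≡ −1 (mod q), so (q − 1) y inverts a
    reduce-inverse ((q ∸ 1) * y) (0<i*a 0<[q∸1]y) (subst (λ m → q ∣ m ∸ 1) (sym (*-assoc (q ∸ 1) y a))
      (∣1+n⇒∣[q∸1]*n∸1 1<q (0<i*a 0<y) (divides x 1+ya≡xq)))
    where
    0<y : 0 < y
    0<y = n≢0⇒n>0 λ { refl → <⇒≢ 1<q (sym (∣1⇒≡1 (divides x 1+ya≡xq))) }
    0<[q∸1]y : 0 < (q ∸ 1) * y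
    0<[q∸1]y = *-mono-≤ (m<n⇒0<n∸m 1<q) 0<y

μ-on-range : ℕ → ℕ → ℕ
μ-on-range N k = if inRange N k then μ N k else 0

module Semiprime {p q : ℕ} (p-prime : Prime p) (q-prime : Prime q) where

  N : ℕ
  N = p * q

  instance
    p≢0 : NonZero p
    p≢0 = prime⇒nonZero p-prime

    q≢0 : NonZero q
    q≢0 = prime⇒nonZero q-prime

    N≢0 : NonZero N
    N≢0 = m*n≢0 p q

  private
    1<p : 1 < p
    1<p = nonTrivial⇒n>1 p {{prime⇒nonTrivial p-prime}}

    1<q : 1 < q
    1<q = nonTrivial⇒n>1 q {{prime⇒nonTrivial q-prime}}

    1<N : 1 < N
    1<N = ≤-trans 1<p (m≤m*n p q)

  gcd[m,N]≡1 : ∀ m → p ∤ m → q ∤ m → gcd m N ≡ 1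
  gcd[m,N]≡1 m p∤m q∤m with divisor-of-prime*prime p-prime q-prime (gcd[m,n]∣n m N)
  ... | inj₁ g≡1               = g≡1
  ... | inj₂ (inj₁ g≡p)        = ⊥-elim (p∤m (subst (_∣ m) g≡p (gcd[m,n]∣m m N)))
  ... | inj₂ (inj₂ (inj₁ g≡q)) = ⊥-elim (q∤m (subst (_∣ m) g≡q (gcd[m,n]∣m m N)))
  ... | inj₂ (inj₂ (inj₂ g≡N)) = ⊥-elim (p∤m (∣-trans (m∣m*n q) (subst (_∣ m) g≡N (gcd[m,n]∣m m N))))

  q∣⇒gcd[m,N]≢1 : ∀ {m} → q ∣ m → gcd m N ≢ 1
  q∣⇒gcd[m,N]≢1 q∣m g≡1 = <⇒≢ 1<q (sym (∣1⇒≡1 (subst (q ∣_) g≡1 (gcd-greatest q∣m (n∣m*n p)))))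

  μ≡1-if-q∤ : ∀ {k} → p ∣ k → 0 < k → q ∤ k ∸ 1 → μ N k ≡ 1
  μ≡1-if-q∤ {k} p∣k 0<k q∤k∸1 = μ≡1 k 1<N (gcd[m,N]≡1 (k ∸ 1) (∣n⇒∤n∸1 1<p 0<k p∣k) q∤k∸1)

  μ≡2-if-q∣ : ∀ {k} → p ∣ k → 0 < k → q ∣ k ∸ 1 → μ N k ≡ 2
  μ≡2-if-q∣ {suc m} p∣k _ q∣m = μ≡2 (suc m) 1<N (q∣⇒gcd[m,N]≢1 q∣m) (gcd[m,N]≡1 (2 * suc m ∸ 1) p∤ q∤)
    where
    p∤ : p ∤ 2 * suc m ∸ 1
    p∤ = ∣n⇒∤n∸1 1<p z<s (∣n⇒∣m*n 2 p∣k)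
    q∤ : q ∤ 2 * suc m ∸ 1
    q∤ q∣ = ∣n⇒∤1+n 1<q (∣n⇒∣m*n 2 q∣m) (subst (q ∣_) (+-suc m (m + 0)) q∣)

  δ≡p : p ≤ q → ∀ k → inRange N k ≡ true → δ N k ≡ p
  δ≡p p≤q k k∈ with inRange-elim N k k∈ | divisor-of-prime*prime p-prime q-prime (gcd[m,n]∣n k N)
  ... | 1<δ , _  | inj₁ δ≡1               = contradiction δ≡1 (>⇒≢ 1<δ)
  ... | _ , _    | inj₂ (inj₁ δ≡p)        = δ≡p
  ... | _ , δ²<N | inj₂ (inj₂ (inj₁ δ≡q)) =
    contradiction (subst (λ d → d * d < N) δ≡q δ²<N) (≤⇒≯ (*-monoˡ-≤ q p≤q))
  ... | _ , δ²<N | inj₂ (inj₂ (inj₂ δ≡N)) =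
    contradiction (subst (λ d → d * d < N) δ≡N δ²<N) (≤⇒≯ (m≤m*n N N))

  δ[i*p]≡p : ∀ {i} → 0 < i → i < q → δ N (i * p) ≡ p
  δ[i*p]≡p {i} 0<i i<q = begin
    gcd (i * p) (p * q)  ≡⟨ cong (λ x → gcd x (p * q)) (*-comm i p) ⟩
    gcd (p * i) (p * q)  ≡⟨ c*gcd[m,n]≡gcd[cm,cn] p i q ⟨
    p * gcd i q          ≡⟨ cong (p *_) gcd[i,q]≡1 ⟩
    p * 1                ≡⟨ *-identityʳ p ⟩
    p                    ∎
    where
    open ≡-Reasoning
    gcd[i,q]≡1 : gcd i q ≡ 1
    gcd[i,q]≡1 = trans (gcd-comm i q) (coprime⇒gcd≡1 (prime⇒coprime q-prime {{>-nonZero 0<i}} i<q))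

  inRange[i*p] : p < q → ∀ {i} → 0 < i → i < q → inRange N (i * p) ≡ true
  inRange[i*p] p<q {i} 0<i i<q = inRange-intro N (i * p)
    (<-≤-trans 1<p (m≤n*m p i {{>-nonZero 0<i}}))
    (subst (_< N) (*-comm p i) (*-monoʳ-< p i<q))
    (subst (1 <_) (sym (δ[i*p]≡p 0<i i<q)) 1<p)
    (subst (λ d → d * d < N) (sym (δ[i*p]≡p 0<i i<q)) (*-monoʳ-< p p<q))

  ¬inRange[i*p+r] : p ≤ q → ∀ i {r} → 0 < r → r < p → inRange N (i * p + r) ≡ false
  ¬inRange[i*p+r] p≤q i {r} 0<r r<p = ¬-not λ k∈ → <⇒≱ r<p (∣⇒≤ {{>-nonZero 0<r}} (p∣r k∈))
    where
    p∣r : inRange N (i * p + r) ≡ true → p ∣ r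
    p∣r k∈ = ∣m+n∣m⇒∣n (subst (_∣ i * p + r) (δ≡p p≤q (i * p + r) k∈) (gcd[m,n]∣m (i * p + r) N)) (n∣m*n i)

  sumBelow-μ-on-range : p < q → sumBelow N (μ-on-range N) ≡ q
  sumBelow-μ-on-range p<q = begin
    sumBelow (p * q) g                                    ≡⟨ cong (λ n → sumBelow n g) (*-comm p q) ⟩
    sumBelow (q * p) g                                    ≡⟨ sumBelow-* q p g ⟩
    sumBelow q (λ i → sumBelow p (λ r → g (i * p + r)))   ≡⟨ sumBelow-cong q (λ i _ → block i) ⟩
    sumBelow q (λ i → g (i * p + 0))                      ≡⟨ sumBelow-bump q 0<i₀ i₀<q refl g[i₀p]≡2 g[ip]≡1 ⟩
    q                                                     ∎
    where
    open ≡-Reasoning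
    open ModularInverse q-prime (>⇒∤ p<q)
    g = μ-on-range N

    -- in the block [i p, i p + p) only i p can be in range, as δ_k = p forces p ∣ k
    block : ∀ i → sumBelow p (λ r → g (i * p + r)) ≡ g (i * p + 0)
    block i = sumBelow-head p (>-nonZero⁻¹ p) λ r 0<r r<p →
      cong (λ b → if b then μ N (i * p + r) else 0) (¬inRange[i*p+r] (<⇒≤ p<q) i 0<r r<p)

    g[ip]≡μ[ip] : ∀ {i} → 0 < i → i < q → g (i * p + 0) ≡ μ N (i * p)
    g[ip]≡μ[ip] {i} 0<i i<q rewrite +-identityʳ (i * p) =
      cong (λ b → if b then μ N (i * p) else 0) (inRange[i*p] p<q 0<i i<q)

    0<ip : ∀ {i} → 0 < i → 0 < i * p
    0<ip 0<i = *-mono-≤ 0<i (>-nonZero⁻¹ p)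

    i₀ : ℕ
    i₀ = proj₁ inverse-exists
    0<i₀ : 0 < i₀
    0<i₀ = proj₁ (proj₂ inverse-exists)
    i₀<q : i₀ < q
    i₀<q = proj₁ (proj₂ (proj₂ inverse-exists))
    q∣i₀p∸1 : q ∣ i₀ * p ∸ 1
    q∣i₀p∸1 = proj₂ (proj₂ (proj₂ inverse-exists))

    g[i₀p]≡2 : g (i₀ * p + 0) ≡ 2
    g[i₀p]≡2 = trans (g[ip]≡μ[ip] 0<i₀ i₀<q) (μ≡2-if-q∣ (n∣m*n i₀) (0<ip 0<i₀) q∣i₀p∸1)

    g[ip]≡1 : ∀ i → 0 < i → i < q → i ≢ i₀ → g (i * p + 0) ≡ 1
    g[ip]≡1 i 0<i i<q i≢i₀ = trans (g[ip]≡μ[ip] 0<i i<q) (μ≡1-if-q∤ (n∣m*n i) (0<ip 0<i)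
      λ q∣ip∸1 → i≢i₀ (inverse-unique 0<i i<q 0<i₀ i₀<q q∣ip∸1 q∣i₀p∸1))

  S≡Σμ*[1-p*p/N] : p ≤ q → S N ≡ frac (sumBelow N (μ-on-range N)) 1 ℚ.* (1ℚ ℚ.- frac (p * p) N)
  S≡Σμ*[1-p*p/N] p≤q =
    trans (sum-map-filterᵇ (inRange N) (μ N) _ _ δ-is-p (upTo N))
          (cong (λ n → frac n 1 ℚ.* (1ℚ ℚ.- frac (p * p) N)) (sum-map-applyUpTo N id (μ-on-range N)))
    where
    δ-is-p : ∀ k → inRange N k ≡ true →
             frac (μ N k) 1 ℚ.* (1ℚ ℚ.- frac (δ N k * δ N k) N) ≡ frac (μ N k) 1 ℚ.* (1ℚ ℚ.- frac (p * p) N)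
    δ-is-p k k∈ = cong (λ d → frac (μ N k) 1 ℚ.* (1ℚ ℚ.- frac (d * d) N)) (δ≡p p≤q k k∈)

mainTheorem17 : (p₁ p₂ : ℕ) → Prime p₁ → Prime p₂ → p₁ ≤ p₂ →
    S (p₁ * p₂) ≡ frac (p₂ ∸ p₁) 1
mainTheorem17 p q p-prime q-prime p≤q with m≤n⇒m<n∨m≡n p≤q
... | inj₁ p<q = begin
  S (p * q)                                ≡⟨ S≡Σμ*[1-p*p/N] p≤q ⟩
  frac (sumBelow N (μ-on-range N)) 1 ℚ.* c ≡⟨ cong (λ n → frac n 1 ℚ.* c) (sumBelow-μ-on-range p<q) ⟩
  frac q 1 ℚ.* c                           ≡⟨ n*[1-m*m/m*n]≡n∸m p q p≤q ⟩
  frac (q ∸ p) 1                           ∎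
  where
  open ≡-Reasoning
  open Semiprime p-prime q-prime
  c = 1ℚ ℚ.- frac (p * p) N
... | inj₂ refl = begin
  S (p * p)                                      ≡⟨ S≡Σμ*[1-p*p/N] p≤q ⟩
  frac Σμ 1 ℚ.* (1ℚ ℚ.- frac (p * p) (p * p))    ≡⟨ cong (frac Σμ 1 ℚ.*_) (1-n/n≡0 (p * p)) ⟩
  frac Σμ 1 ℚ.* 0ℚ                               ≡⟨ ℚ.*-zeroʳ (frac Σμ 1) ⟩
  0ℚ                                             ≡⟨ cong (λ n → frac n 1) (n∸n≡0 p) ⟨
  frac (p ∸ p) 1                                 ∎
  where
  open ≡-Reasoning
  open Semiprime p-prime q-prime
  Σμ = sumBelow N (μ-on-range N)
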